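{- For every $\lambda$-term $M$, $\{H_r(a)\mid a\in T_r(M),\ H_r(a)\neq0\}=T_r(H(M))$.
   Context: Rigid resource terms: $a ::= x\mid \lambda x.a\mid \langle c\rangle\vec d\mid 0$, $\vec d=(d_1,\dots,d_n)$ a finite list of rigid terms; up to $\alpha$; $0$ absorbing. Rigid substitution $a[\vec b/x]$, $\vec b=(b_1,\dots,b_k)$: if $x$ has exactly $k$ free occurrences in $a$, replace the $i$-th (left-to-right) by $b_i$; else $0$. Rigid expansion: $T_r(x)=\{x\}$, $T_r(\lambda x.M)=\{\lambda x.a\mid a\in T_r(M)\}$, $T_r(PQ)=\{\langle c\rangle(d_1,\dots,d_n)\mid c\in T_r(P), n\ge0, d_i\in T_r(Q)\}$. Every nonzero rigid term is $\lambda x_1\dots\lambda x_m.\langle\cdots\langle a'\rangle\vec b_1\cdots\rangle\vec b_n$ with $a'$ a variable (head-normal form) or a redex $\langle\lambda x.c\rangle\vec d$; $0$ is a head-normal form. $H_r$ fixes head-normal forms and maps $\lambda\vec x.\langle\cdots\langle\langle\lambda x.c\rangle\vec d\rangle\vec d_1\cdots\rangle\vec d_n$ to $\lambda\vec x.\langle\cdots\langle c[\vec d/x]\rangle\vec d_1\cdots\rangle\vec d_n$. For $\lambda$-terms, $H$ fixes head-normal forms $\lambda\vec x.yN_1\dots N_n$ and maps $\lambda\vec x.(\lambda x.P)QQ_1\dots Q_n$ to $\lambda\vec x.P[Q/x]Q_1\dots Q_n$. -}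

module Defs where

open import Data.Nat using (ℕ; zero; suc; _+_; _∸_; _<ᵇ_; _≡ᵇ_)
open import Data.Bool using (Bool; true; false; if_then_else_)
open import Data.List using (List; []; _∷_)
open import Data.List.Relation.Unary.All using (All)
open import Data.Maybe using (Maybe; just; nothing)
open import Data.Product using (_×_; _,_)

-- Terms are represented with (unscoped) de Bruijn indices, so that
-- α-equivalence is syntactic equality.

data Λ : Set where
  var : ℕ → Λ
  lam : Λ → Λ
  app : Λ → Λ → Λ

shift : ℕ → ℕ → Λ → Λ
shift d c (var x) = var (if x <ᵇ c then x else x + d)
shift d c (lam t) = lam (shift d (suc c) t)
shift d c (app t u) = app (shift d c t) (shift d c u)

-- subst k Q P : substitute Q for the variable bound k binders above,
-- decrementing the free variables above it (capture-avoiding β-substitution)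
subst : ℕ → Λ → Λ → Λ
subst k Q (var x) =
  if x <ᵇ k then var x else (if x ≡ᵇ k then shift k 0 Q else var (x ∸ 1))
subst k Q (lam P) = lam (subst (suc k) Q P)
subst k Q (app P P') = app (subst k Q P) (subst k Q P')

-- P[Q/x] where P is the body of λx.P
_[_/0] : Λ → Λ → Λ
P [ Q /0] = subst 0 Q P

H : Λ → Λ
H (var x) = var x
H (lam P) = lam (H P)
H (app (lam P) Q) = P [ Q /0]
H (app (var x) Q) = app (var x) Q
H (app (app P P') Q) = app (H (app P P')) Q

-- Rigid resource terms.  Nonzero rigid terms are the syntax below; since
-- 0 is absorbing, a rigid term that may be 0 is represented as
-- Maybe Rig, with nothing standing for 0.

data Rig : Set where
  var : ℕ → Rig
  lam : Rig → Rig
  app : Rig → List Rig → Rig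

mutual
  rshift : ℕ → ℕ → Rig → Rig
  rshift d c (var x) = var (if x <ᵇ c then x else x + d)
  rshift d c (lam t) = lam (rshift d (suc c) t)
  rshift d c (app t us) = app (rshift d c t) (rshiftList d c us)

  rshiftList : ℕ → ℕ → List Rig → List Rig
  rshiftList d c [] = []
  rshiftList d c (u ∷ us) = rshift d c u ∷ rshiftList d c us

-- Linear substitution, left to right: rsubst k a bs consumes the list bs,
-- replacing the i-th (left-to-right) occurrence of the variable bound k
-- binders above by the i-th element; fails (0) if bs is too short.
mutual
  rsubst : ℕ → Rig → List Rig → Maybe (Rig × List Rig)
  rsubst k (var x) bs with x <ᵇ k | x ≡ᵇ k
  ... | true  | _     = just (var x , bs)
  ... | false | false = just (var (x ∸ 1) , bs)
  ... | false | true  with bs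
  ...   | []       = nothing
  ...   | b ∷ bs'  = just (rshift k 0 b , bs')
  rsubst k (lam a) bs with rsubst (suc k) a bs
  ... | nothing = nothing
  ... | just (a' , bs') = just (lam a' , bs')
  rsubst k (app c ds) bs with rsubst k c bs
  ... | nothing = nothing
  ... | just (c' , bs') with rsubstList k ds bs'
  ...   | nothing = nothing
  ...   | just (ds' , bs'') = just (app c' ds' , bs'')

  rsubstList : ℕ → List Rig → List Rig → Maybe (List Rig × List Rig)
  rsubstList k [] bs = just ([] , bs)
  rsubstList k (d ∷ ds) bs with rsubst k d bs
  ... | nothing = nothing
  ... | just (d' , bs') with rsubstList k ds bs'
  ...   | nothing = nothing
  ...   | just (ds' , bs'') = just (d' ∷ ds' , bs'')

-- a[b⃗/x] for a the body of λx.a: nonzero iff x has exactly length b⃗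
-- free occurrences in a.
_⟦_/0⟧ : Rig → List Rig → Maybe Rig
a ⟦ bs /0⟧ with rsubst 0 a bs
... | nothing = nothing
... | just (a' , []) = just a'
... | just (a' , _ ∷ _) = nothing

Hr : Rig → Maybe Rig
Hr (var x) = just (var x)
Hr (lam a) with Hr a
... | nothing = nothing
... | just a' = just (lam a')
Hr (app (lam c) ds) = c ⟦ ds /0⟧
Hr (app (var x) ds) = just (app (var x) ds)
Hr (app (app c ds') ds) with Hr (app c ds')
... | nothing = nothing
... | just c' = just (app c' ds)

data _∈T_ : Rig → Λ → Set where
  var : ∀ {x} → var x ∈T var x
  lam : ∀ {a M} → a ∈T M → lam a ∈T lam M
  app : ∀ {c ds P Q} → c ∈T P → All (_∈T Q) ds → app c ds ∈T app P Q

module Submission where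

-- The only non-structural case is a head β-redex (λx.P) Q, where H_r
-- performs a linear substitution c[d⃗/x] and H a substitution P[Q/x].
-- Everything therefore rests on one fact relating the two substitutions:
--
--   the rigid expansions of P[Q/x] are exactly the nonzero c[d⃗/x]
--   with c ∈ T_r(P) and every dᵢ ∈ T_r(Q).
--
-- With de Bruijn indices this needs first that shifting commutes with
-- expansion (both directions: `∈T-shift`, `∈T-unshift`).  The substitution
-- fact is then proved at an arbitrary depth k and with an arbitrary
-- unconsumed tail of the argument list, as `rsubst` threads that list
-- left to right (`∈T-rsubst`, `∈T-unrsubst`); specialising to depth 0 and
-- an empty tail gives the β-case (`∈T-β`, `∈T-unβ`).

open import Defs
open import Data.Bool using (true; false)
open import Data.Nat using (suc; _∸_; _<ᵇ_; _≡ᵇ_)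
open import Data.List using (List; []; _∷_)
open import Data.List.Relation.Unary.All using (All; []; _∷_)
open import Data.Maybe using (just)
open import Data.Product using (Σ; _×_; _,_; proj₁)
open import Relation.Binary.PropositionalEquality using (_≡_; refl)
open import Function.Bundles using (_⇔_; mk⇔)

mutual
  ∈T-shift : ∀ d c {b Q} → b ∈T Q → rshift d c b ∈T shift d c Q
  ∈T-shift d c var        = var
  ∈T-shift d c (lam h)    = lam (∈T-shift d (suc c) h)
  ∈T-shift d c (app h hs) = app (∈T-shift d c h) (∈T-shiftAll d c hs)

  ∈T-shiftAll : ∀ d c {bs Q} → All (_∈T Q) bs →
                All (_∈T shift d c Q) (rshiftList d c bs)
  ∈T-shiftAll d c []       = []
  ∈T-shiftAll d c (h ∷ hs) = ∈T-shift d c h ∷ ∈T-shiftAll d c hs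

mutual
  ∈T-unshift : ∀ d c Q {b} → b ∈T shift d c Q →
               Σ Rig λ b' → b' ∈T Q × rshift d c b' ≡ b
  ∈T-unshift d c (var x) var = var x , var , refl
  ∈T-unshift d c (lam Q) (lam h) with ∈T-unshift d (suc c) Q h
  ... | b' , h' , refl = lam b' , lam h' , refl
  ∈T-unshift d c (app P Q) (app h hs)
    with ∈T-unshift d c P h | ∈T-unshiftAll d c Q hs
  ... | b' , h' , refl | bs' , hs' , refl = app b' bs' , app h' hs' , refl

  ∈T-unshiftAll : ∀ d c Q {bs} → All (_∈T shift d c Q) bs →
                  Σ (List Rig) λ bs' → All (_∈T Q) bs' × rshiftList d c bs' ≡ bs
  ∈T-unshiftAll d c Q [] = [] , [] , refl
  ∈T-unshiftAll d c Q (h ∷ hs) with ∈T-unshift d c Q h | ∈T-unshiftAll d c Q hs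
  ... | b' , h' , refl | bs' , hs' , refl = b' ∷ bs' , h' ∷ hs' , refl

mutual
  ∈T-rsubst : ∀ k Q {P c bs c' rest} → c ∈T P → All (_∈T Q) bs →
              rsubst k c bs ≡ just (c' , rest) →
              c' ∈T subst k Q P × All (_∈T Q) rest
  ∈T-rsubst k Q {var x} var hbs eq with x <ᵇ k | x ≡ᵇ k
  ∈T-rsubst k Q {var x} var hbs refl | true  | _     = var , hbs
  ∈T-rsubst k Q {var x} var hbs refl | false | false = var , hbs
  ∈T-rsubst k Q {var x} {bs = _ ∷ _} var (hb ∷ hbs) refl | false | true =
    ∈T-shift k 0 hb , hbs
  ∈T-rsubst k Q {c = lam a} {bs} (lam h) hbs eq with rsubst (suc k) a bs in e
  ∈T-rsubst k Q (lam h) hbs refl | just _ with ∈T-rsubst (suc k) Q h hbs e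
  ... | h' , hrest = lam h' , hrest
  ∈T-rsubst k Q {c = app c ds} {bs} (app h hs) hbs eq with rsubst k c bs in e₁
  ... | just (_ , bs₁) with ∈T-rsubst k Q h hbs e₁ | rsubstList k ds bs₁ in e₂
  ∈T-rsubst k Q (app h hs) hbs refl | just _ | h' , hbs₁ | just _
    with ∈T-rsubstAll k Q hs hbs₁ e₂
  ... | hs' , hrest = app h' hs' , hrest

  ∈T-rsubstAll : ∀ k Q {P ds bs ds' rest} → All (_∈T P) ds → All (_∈T Q) bs →
                 rsubstList k ds bs ≡ just (ds' , rest) →
                 All (_∈T subst k Q P) ds' × All (_∈T Q) rest
  ∈T-rsubstAll k Q [] hbs refl = [] , hbs
  ∈T-rsubstAll k Q {ds = d ∷ ds} {bs} (h ∷ hs) hbs eq with rsubst k d bs in e₁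
  ... | just (_ , bs₁) with ∈T-rsubst k Q h hbs e₁ | rsubstList k ds bs₁ in e₂
  ∈T-rsubstAll k Q (h ∷ hs) hbs refl | just _ | h' , hbs₁ | just _
    with ∈T-rsubstAll k Q hs hbs₁ e₂
  ... | hs' , hrest = h' ∷ hs' , hrest

-- Lists are rebuilt right to left so that the tail is known in advance.
mutual
  ∈T-unrsubst : ∀ k Q P {b} → b ∈T subst k Q P → ∀ rest → All (_∈T Q) rest →
                Σ Rig λ c → Σ (List Rig) λ bs →
                  c ∈T P × All (_∈T Q) bs × rsubst k c bs ≡ just (b , rest)
  ∈T-unrsubst k Q (var x) h rest hrest with x <ᵇ k in e₁ | x ≡ᵇ k in e₂
  ∈T-unrsubst k Q (var x) var rest hrest | true | _ =
    var x , rest , var , hrest , below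
    where below : rsubst k (var x) rest ≡ just (var x , rest)
          below rewrite e₁ = refl
  ∈T-unrsubst k Q (var x) var rest hrest | false | false =
    var x , rest , var , hrest , above
    where above : rsubst k (var x) rest ≡ just (var (x ∸ 1) , rest)
          above rewrite e₁ | e₂ = refl
  ∈T-unrsubst k Q (var x) h rest hrest | false | true with ∈T-unshift k 0 Q h
  ... | b' , h' , refl = var x , b' ∷ rest , var , h' ∷ hrest , hit
    where hit : rsubst k (var x) (b' ∷ rest) ≡ just (rshift k 0 b' , rest)
          hit rewrite e₁ | e₂ = refl
  ∈T-unrsubst k Q (lam P) {lam b} (lam h) rest hrest
    with ∈T-unrsubst (suc k) Q P h rest hrest
  ... | c , bs , hc , hbs , e = lam c , bs , lam hc , hbs , under-λ
    where under-λ : rsubst k (lam c) bs ≡ just (lam b , rest)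
          under-λ rewrite e = refl
  ∈T-unrsubst k Q (app P P') {app b bs₀} (app h hs) rest hrest
    with ∈T-unrsubstAll k Q P' hs rest hrest
  ... | cs , bs₁ , hcs , hbs₁ , e₂ with ∈T-unrsubst k Q P h bs₁ hbs₁
  ...   | c , bs , hc , hbs , e₁ = app c cs , bs , app hc hcs , hbs , in-app
    where in-app : rsubst k (app c cs) bs ≡ just (app b bs₀ , rest)
          in-app rewrite e₁ | e₂ = refl

  ∈T-unrsubstAll : ∀ k Q P {bs₀} → All (_∈T subst k Q P) bs₀ →
                   ∀ rest → All (_∈T Q) rest →
                   Σ (List Rig) λ cs → Σ (List Rig) λ bs →
                     All (_∈T P) cs × All (_∈T Q) bs ×
                     rsubstList k cs bs ≡ just (bs₀ , rest)
  ∈T-unrsubstAll k Q P [] rest hrest = [] , rest , [] , hrest , refl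
  ∈T-unrsubstAll k Q P {b ∷ bs₀} (h ∷ hs) rest hrest
    with ∈T-unrsubstAll k Q P hs rest hrest
  ... | cs , bs₁ , hcs , hbs₁ , e₂ with ∈T-unrsubst k Q P h bs₁ hbs₁
  ...   | c , bs , hc , hbs , e₁ = c ∷ cs , bs , hc ∷ hcs , hbs , in-list
    where in-list : rsubstList k (c ∷ cs) bs ≡ just (b ∷ bs₀ , rest)
          in-list rewrite e₁ | e₂ = refl

∈T-β : ∀ P Q {c ds b} → c ∈T P → All (_∈T Q) ds →
       c ⟦ ds /0⟧ ≡ just b → b ∈T (P [ Q /0])
∈T-β P Q {c} {ds} hc hds eq with rsubst 0 c ds in e
∈T-β P Q hc hds refl | just (_ , []) = proj₁ (∈T-rsubst 0 Q hc hds e)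

∈T-unβ : ∀ P Q {b} → b ∈T (P [ Q /0]) →
         Σ Rig λ c → Σ (List Rig) λ ds →
           c ∈T P × All (_∈T Q) ds × c ⟦ ds /0⟧ ≡ just b
∈T-unβ P Q {b} h with ∈T-unrsubst 0 Q P h [] []
... | c , ds , hc , hds , e = c , ds , hc , hds , exact
  where exact : c ⟦ ds /0⟧ ≡ just b
        exact rewrite e = refl

Hr-sound : ∀ M {a b} → a ∈T M → Hr a ≡ just b → b ∈T H M
Hr-sound (var x) var refl = var
Hr-sound (lam M) {lam a} (lam h) eq with Hr a in e
Hr-sound (lam M) (lam h) refl | just _ = lam (Hr-sound M h e)
Hr-sound (app (var x) Q) (app var hs) refl = app var hs
Hr-sound (app (lam P) Q) (app (lam h) hs) eq = ∈T-β P Q h hs eq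
Hr-sound (app (app P P') Q) {app (app c ds') ds} (app h hs) eq
  with Hr (app c ds') in e
Hr-sound (app (app P P') Q) (app h hs) refl | just _ =
  app (Hr-sound (app P P') h e) hs

Hr-complete : ∀ M {b} → b ∈T H M → Σ Rig λ a → a ∈T M × Hr a ≡ just b
Hr-complete (var x) var = var x , var , refl
Hr-complete (lam M) {lam b} (lam h) with Hr-complete M h
... | a , ha , e = lam a , lam ha , under-λ
  where under-λ : Hr (lam a) ≡ just (lam b)
        under-λ rewrite e = refl
Hr-complete (app (var x) Q) (app var hs) = _ , app var hs , refl
Hr-complete (app (lam P) Q) h with ∈T-unβ P Q h
... | c , ds , hc , hds , e = app (lam c) ds , app (lam hc) hds , e
Hr-complete (app (app P P') Q) {app b ds} (app h hs)
  with Hr-complete (app P P') h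
... | app c ds' , ha , e = app (app c ds') ds , app ha hs , in-head
  where in-head : Hr (app (app c ds') ds) ≡ just (app b ds)
        in-head rewrite e = refl

mainTheorem10 : (M : Λ) (b : Rig) →
    (Σ Rig (λ a → a ∈T M × Hr a ≡ just b)) ⇔ (b ∈T H M)
mainTheorem10 M b =
  mk⇔ (λ { (a , ha , eq) → Hr-sound M ha eq }) (Hr-complete M)
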